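{- Let $G=(V,E)$ be a finite strongly connected directed graph (loops and multiple arcs allowed), let $s\in V$ and let $T\subseteq V$ be nonempty such that every arc leaving a vertex of $T$ ends at $s$. Let $m\ge1$. Fix at every vertex $v$ a rotor mechanism with heads $v^1,v^2,\dots$ (periodic with period $d(v)$), and suppose every rotor mechanism is $m$-repetitive: $v^{am+1}=v^{am+2}=\dots=v^{am+m}$ for all $v\in V$ and all integers $a\ge0$. Then the hitting sequence $(t_n)_{n\ge1}$ is $m$-repetitive: $t_{am+1}=t_{am+2}=\dots=t_{am+m}$ for all $a\ge0$.
   Context: $d(v)$ is the out-degree of $v$. A rotor mechanism at $v$ is an ordering $e_v^1,\dots,e_v^{d(v)}$ of the arcs leaving $v$, extended to all $i\in\mathbb{Z}$ periodically with period $d(v)$; $v^i$ is the head of $e_v^i$. The rotor walk from $s$ is the infinite sequence $x_0=s,x_1,\dots$ in which, for every vertex $v$ and $i\ge1$, the $i$-th occurrence of $v$ is immediately followed by $v^i$; the hitting sequence is the subsequence of terms of the rotor walk lying in $T$. -}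

module Defs where

open import Data.Nat using (ℕ; zero; suc; _+_; _*_; _∸_; _<_; _≤_; NonZero)
open import Data.Nat.DivMod using (_mod_)
open import Data.Fin using (Fin; _≟_)
open import Data.Fin.Subset using (Subset; _∈_)
open import Data.Fin.Subset.Properties using (_∈?_)
open import Data.Product using (_×_; _,_; proj₁; proj₂; ∃)
open import Data.Bool using (if_then_else_)
open import Relation.Nullary.Decidable using (⌊_⌋; does)
open import Relation.Binary.PropositionalEquality using (_≡_)
open import Relation.Binary.Construct.Closure.ReflexiveTransitive using (Star)

-- A finite directed multigraph (loops / multiple arcs allowed) on vertex set Fin n,
-- together with a rotor mechanism at every vertex: the arcs leaving v are
-- e_v^1, ..., e_v^{d v}, and  head v i  is the head of e_v^{i+1} (0-based index).
record RotorGraph (n : ℕ) : Set where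
  field
    d    : Fin n → ℕ
    head : (v : Fin n) → Fin (d v) → Fin n

module _ {n : ℕ} (G : RotorGraph n) where
  open RotorGraph G

  Arc : Fin n → Fin n → Set
  Arc u w = ∃ λ (i : Fin (d u)) → head u i ≡ w

  StronglyConnected : Set
  StronglyConnected = ∀ u w → Star Arc u w

  OutDegPos : Set
  OutDegPos = ∀ v → NonZero (d v)

  module Walk (nz : OutDegPos) where
    -- v^i for every i : ℕ, periodic with period d v (v^i = head of e_v^i,
    -- indices i ≡ 1 .. d v mod d v correspond to 0-based positions 0 .. d v - 1)
    vhead : Fin n → ℕ → Fin n
    vhead v i = head v (_mod_ (i + d v ∸ 1) (d v) {{nz v}})

    MRepetitive : ℕ → Fin n → Set
    MRepetitive m v = ∀ (a j : ℕ) → j < m → vhead v (a * m + 1 + j) ≡ vhead v (a * m + 1)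

    -- rotor walk from s: state = (current vertex x_k, c) where c w is the number
    -- of occurrences of w among x_0, ..., x_k.
    inc : (Fin n → ℕ) → Fin n → (Fin n → ℕ)
    inc c y w = if does (w ≟ y) then suc (c w) else c w

    walkState : Fin n → ℕ → Fin n × (Fin n → ℕ)
    walkState s zero = s , (λ w → if does (w ≟ s) then 1 else 0)
    walkState s (suc k) with walkState s k
    ... | x , c = vhead x (c x) , inc c (vhead x (c x))

    rotorWalk : Fin n → ℕ → Fin n
    rotorWalk s k = proj₁ (walkState s k)

    hitsBefore : Fin n → Subset n → ℕ → ℕ
    hitsBefore s T zero = 0
    hitsBefore s T (suc k) =
      hitsBefore s T k + (if does (rotorWalk s k ∈? T) then 1 else 0)

    -- index k of the rotor walk is the position of the r-th term (r ≥ 1)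
    -- of the hitting sequence, i.e. t_r = x_k
    IsHit : Fin n → Subset n → ℕ → ℕ → Set
    IsHit s T r k = rotorWalk s k ∈ T × suc (hitsBefore s T k) ≡ r

-- Think of the walk as one chip: each visit to T is a hit, after which the chip returns to s.
-- Cut the walk into blocks of m hits.  A block starts with the chip at s and every vertex
-- outside T left a multiple of m times.  Compare the block with the process that moves m
-- chips together from s: by m-repetitivity they travel as one, until they stop at a single
-- vertex t ∈ T.  By the least action principle of chip-firing the departures of the walk
-- during the block are bounded by those of this process, and by the reverse inequality they
-- coincide when the block ends.  Hence every hit of the block is at t, and the next block
-- again starts aligned.  Both comparisons rest on counting chips (conservation).

module Submission where

open import Defs
open import Data.Nat using (ℕ; zero; suc; _+_; _*_; _<_; _≤_; _≤′_; ≤′-refl; ≤′-step; z≤n; s≤s⁻¹)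
open import Data.Nat.Properties hiding (_≟_)
open import Data.Nat.Divisibility using (_∣_; divides; _∣0; m∣m*n; ∣m∣n⇒∣m+n)
open import Data.Nat.Tactic.RingSolver using (solve-∀)
open import Data.Fin using (Fin; _≟_; punchIn)
open import Data.Fin.Properties using (punchInᵢ≢i)
open import Data.Fin.Subset using (Subset; _∈_; _∉_; Nonempty)
open import Data.Fin.Subset.Properties using (_∈?_)
open import Data.Vec.Functional using (Vector)
open import Data.Product using (_×_; _,_; proj₁; proj₂; ∃-syntax; uncurry)
open import Data.Sum using (inj₁; inj₂)
open import Data.Bool using (if_then_else_)
open import Function using (_∘_)
open import Relation.Nullary using (Dec; yes; no; does; contradiction)
open import Relation.Nullary.Decidable using (dec-true; dec-false)
open import Relation.Binary.PropositionalEquality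
open import Algebra.Properties.CommutativeMonoid.Sum +-0-commutativeMonoid
  using (sum; sum-cong-≗; sum-remove; sum-replicate-zero)

sum-mono-≤ : ∀ {n} {f g : Vector ℕ n} → (∀ i → f i ≤ g i) → sum f ≤ sum g
sum-mono-≤ {zero}  f≤g = z≤n
sum-mono-≤ {suc n} f≤g = +-mono-≤ (f≤g _) (sum-mono-≤ (f≤g ∘ Fin.suc))

sum-exchange : ∀ {n} (f g : Vector ℕ n) (i : Fin n) → (∀ j → j ≢ i → f j ≡ g j) →
               g i + sum f ≡ f i + sum g
sum-exchange {suc n} f g i f≡g = begin
  g i + sum f                        ≡⟨ cong (g i +_) (sum-remove {i = i} f) ⟩
  g i + (f i + sum (f ∘ punchIn i))  ≡⟨ cong (λ r → g i + (f i + r)) rest-equal ⟩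
  g i + (f i + sum (g ∘ punchIn i))  ≡⟨ x+[y+z]≡y+[x+z] (g i) (f i) _ ⟩
  f i + (g i + sum (g ∘ punchIn i))  ≡⟨ cong (f i +_) (sum-remove {i = i} g) ⟨
  f i + sum g                        ∎
  where
  open ≡-Reasoning
  x+[y+z]≡y+[x+z] : ∀ x y z → x + (y + z) ≡ y + (x + z)
  x+[y+z]≡y+[x+z] = solve-∀
  rest-equal : sum (f ∘ punchIn i) ≡ sum (g ∘ punchIn i)
  rest-equal = sum-cong-≗ (λ j → f≡g (punchIn i j) (punchInᵢ≢i i j))

mono-≤-from-suc : (f : ℕ → ℕ) → (∀ k → f k ≤ f (suc k)) → ∀ {k l} → k ≤ l → f k ≤ f l
mono-≤-from-suc f f-step k≤l = go (≤⇒≤′ k≤l)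
  where
  go : ∀ {k l} → k ≤′ l → f k ≤ f l
  go ≤′-refl        = ≤-refl
  go (≤′-step k≤′l) = ≤-trans (go k≤′l) (f-step _)

δ : ∀ {n} → Fin n → Fin n → ℕ
δ v w = if does (v ≟ w) then 1 else 0

δ-refl : ∀ {n} (v : Fin n) → δ v v ≡ 1
δ-refl v = cong (λ b → if b then 1 else 0) (dec-true (v ≟ v) refl)

δ-≢ : ∀ {n} {v w : Fin n} → v ≢ w → δ v w ≡ 0
δ-≢ {v = v} {w} v≢w = cong (λ b → if b then 1 else 0) (dec-false (v ≟ w) v≢w)

∉∧∈⇒≢ : ∀ {n} {T : Subset n} {u x} → u ∉ T → x ∈ T → u ≢ x
∉∧∈⇒≢ u∉T x∈T refl = u∉T x∈T

fire : ∀ {n} → Vector ℕ n → Fin n → ℕ → Vector ℕ n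
fire c u d w = c w + d * δ w u

fire-self : ∀ {n} (c : Vector ℕ n) u d → fire c u d u ≡ c u + d
fire-self c u d = trans (cong (λ x → c u + d * x) (δ-refl u)) (cong (c u +_) (*-identityʳ d))

fire-≢ : ∀ {n} (c : Vector ℕ n) {u w} d → w ≢ u → fire c u d w ≡ c w
fire-≢ c {u} {w} d w≢u = begin
  c w + d * δ w u  ≡⟨ cong (λ x → c w + d * x) (δ-≢ w≢u) ⟩
  c w + d * 0      ≡⟨ cong (c w +_) (*-zeroʳ d) ⟩
  c w + 0          ≡⟨ +-identityʳ (c w) ⟩
  c w              ∎
  where open ≡-Reasoning

fire-mono-≤ : ∀ {n} {c g : Vector ℕ n} {u d e w} → c w ≤ g w → d ≤ e → fire c u d w ≤ fire g u e w
fire-mono-≤ {u = u} {w = w} c≤g d≤e = +-mono-≤ c≤g (*-monoˡ-≤ (δ w u) d≤e)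

fire-once-≤ : ∀ {n} {c g : Vector ℕ n} {u w} → c u < g u → c w ≤ g w → fire c u 1 w ≤ g w
fire-once-≤ {c = c} {g} {u} {w} cu<gu cw≤gw = by-cases (w ≟ u)
  where
  by-cases : Dec (w ≡ u) → fire c u 1 w ≤ g w
  by-cases (yes refl) = ≤-trans (≤-reflexive (trans (fire-self c u 1) (+-comm (c u) 1))) cu<gu
  by-cases (no w≢u)   = ≤-trans (≤-reflexive (fire-≢ c 1 w≢u)) cw≤gw

module Rotor {n} (G : RotorGraph n) (nz : OutDegPos G) where
  open RotorGraph G
  open Walk G nz

  -- route u i = u^(i+1): departures from u are numbered from 0.
  route : Fin n → ℕ → Fin n
  route u i = vhead u (suc i)

  arrivals : Fin n → ℕ → Fin n → ℕ
  arrivals u zero    v = 0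
  arrivals u (suc k) v = arrivals u k v + δ v (route u k)

  arrivals-mono : ∀ u {k l v} → k ≤ l → arrivals u k v ≤ arrivals u l v
  arrivals-mono u {v = v} = mono-≤-from-suc (λ k → arrivals u k v) (λ k → m≤m+n _ _)

  module _ {m u} (rep : MRepetitive m u) where

    route-block : ∀ r {i} → i < m → route u (i + r * m) ≡ route u (r * m)
    route-block r {i} i<m = begin
      vhead u (suc (i + r * m))  ≡⟨ cong (vhead u) (suc[i+x]≡x+1+i i (r * m)) ⟩
      vhead u (r * m + 1 + i)    ≡⟨ rep r i i<m ⟩
      vhead u (r * m + 1)        ≡⟨ cong (vhead u) (+-comm (r * m) 1) ⟩
      vhead u (suc (r * m))      ∎
      where
      open ≡-Reasoning
      suc[i+x]≡x+1+i : ∀ i x → suc (i + x) ≡ x + 1 + i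
      suc[i+x]≡x+1+i = solve-∀

    arrivals-block : ∀ r {i v} → i ≤ m →
                     arrivals u (i + r * m) v ≡ i * δ v (route u (r * m)) + arrivals u (r * m) v
    arrivals-block r {zero}      _   = refl
    arrivals-block r {suc i} {v} i<m = begin
      arrivals u (i + r * m) v + δ v (route u (i + r * m))
        ≡⟨ cong₂ _+_ (arrivals-block r (<⇒≤ i<m)) (cong (δ v) (route-block r i<m)) ⟩
      i * x + a + x    ≡⟨ +-comm (i * x + a) x ⟩
      x + (i * x + a)  ≡⟨ +-assoc x (i * x) a ⟨
      suc i * x + a    ∎
      where
      open ≡-Reasoning
      x = δ v (route u (r * m))
      a = arrivals u (r * m) v

  module Inflow (T : Subset n) where

    -- Chips sent to v by c w departures from each w ∉ T; departures from T are the hits.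
    flow : Vector ℕ n → Fin n → Fin n → ℕ
    flow c v w = if does (w ∈? T) then 0 else arrivals w (c w) v

    inflow : Vector ℕ n → Fin n → ℕ
    inflow c v = sum (flow c v)

    _≼_ : Vector ℕ n → Vector ℕ n → Set
    c ≼ g = ∀ u → u ∉ T → c u ≤ g u

    flow-∉ : ∀ c v {u} → u ∉ T → flow c v u ≡ arrivals u (c u) v
    flow-∉ c v {u} u∉T = cong (λ b → if b then 0 else arrivals u (c u) v) (dec-false (u ∈? T) u∉T)

    inflow-cong : ∀ {c g} → (∀ u → u ∉ T → c u ≡ g u) → ∀ v → inflow c v ≡ inflow g v
    inflow-cong {c} {g} c≡g v = sum-cong-≗ flow≗
      where
      flow≗ : ∀ w → flow c v w ≡ flow g v w
      flow≗ w with w ∈? T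
      ... | yes _   = refl
      ... | no w∉T = cong (λ k → arrivals w k v) (c≡g w w∉T)

    inflow-mono : ∀ {c g} → c ≼ g → ∀ v → inflow c v ≤ inflow g v
    inflow-mono {c} {g} c≼g v = sum-mono-≤ flow≤
      where
      flow≤ : ∀ w → flow c v w ≤ flow g v w
      flow≤ w with w ∈? T
      ... | yes _   = z≤n
      ... | no w∉T = arrivals-mono w (c≼g w w∉T)

    inflow-zero : ∀ v → inflow (λ _ → 0) v ≡ 0
    inflow-zero v = trans (sum-cong-≗ flow≗0) (sum-replicate-zero n)
      where
      flow≗0 : ∀ w → flow (λ _ → 0) v w ≡ 0
      flow≗0 w with w ∈? T
      ... | yes _ = refl
      ... | no _  = refl

    inflow-fire-∈ : ∀ c {u d} → u ∈ T → ∀ v → inflow (fire c u d) v ≡ inflow c v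
    inflow-fire-∈ c {u} {d} u∈T = inflow-cong (λ w w∉T → fire-≢ c d (∉∧∈⇒≢ w∉T u∈T))

    inflow-fire-∉ : ∀ {c u d v e} → u ∉ T → arrivals u (c u + d) v ≡ arrivals u (c u) v + e →
                    inflow (fire c u d) v ≡ inflow c v + e
    inflow-fire-∉ {c} {u} {d} {v} {e} u∉T more = +-cancelˡ-≡ (arrivals u (c u) v) _ _ (begin
      arrivals u (c u) v + inflow (fire c u d) v  ≡⟨ cong (_+ inflow (fire c u d) v) (flow-∉ c v u∉T) ⟨
      flow c v u + inflow (fire c u d) v          ≡⟨ sum-exchange (flow c v) (flow (fire c u d) v) u agree ⟨
      flow (fire c u d) v u + inflow c v          ≡⟨ cong (_+ inflow c v) fired ⟩
      arrivals u (c u + d) v + inflow c v         ≡⟨ cong (_+ inflow c v) more ⟩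
      arrivals u (c u) v + e + inflow c v         ≡⟨ +-assoc (arrivals u (c u) v) e _ ⟩
      arrivals u (c u) v + (e + inflow c v)       ≡⟨ cong (arrivals u (c u) v +_) (+-comm e _) ⟩
      arrivals u (c u) v + (inflow c v + e)       ∎)
      where
      open ≡-Reasoning
      fired : flow (fire c u d) v u ≡ arrivals u (c u + d) v
      fired = trans (flow-∉ (fire c u d) v u∉T) (cong (λ k → arrivals u k v) (fire-self c u d))
      agree : ∀ w → w ≢ u → flow c v w ≡ flow (fire c u d) v w
      agree w w≢u = cong (λ k → if does (w ∈? T) then 0 else arrivals w k v) (sym (fire-≢ c d w≢u))

    inflow-fire-once : ∀ c {u} → u ∉ T → ∀ v →
                       inflow (fire c u 1) v ≡ inflow c v + δ v (route u (c u))
    inflow-fire-once c {u} u∉T v =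
      inflow-fire-∉ {c} {u} u∉T (cong (λ k → arrivals u k v) (+-comm (c u) 1))

    inflow-fire-block : ∀ {m c u} → MRepetitive m u → u ∉ T → m ∣ c u → ∀ v →
                        inflow (fire c u m) v ≡ inflow c v + m * δ v (route u (c u))
    inflow-fire-block {m} {c} {u} rep u∉T (divides r cu≡rm) v = inflow-fire-∉ {c} {u} u∉T (begin
      arrivals u (c u + m) v    ≡⟨ cong (λ k → arrivals u (k + m) v) cu≡rm ⟩
      arrivals u (r * m + m) v  ≡⟨ cong (λ k → arrivals u k v) (+-comm (r * m) m) ⟩
      arrivals u (m + r * m) v  ≡⟨ arrivals-block rep r ≤-refl ⟩
      m * x + a                 ≡⟨ +-comm (m * x) a ⟩
      a + m * x                 ≡⟨ cong (λ k → arrivals u k v + m * δ v (route u k)) cu≡rm ⟨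
      arrivals u (c u) v + m * δ v (route u (c u))  ∎)
      where
      open ≡-Reasoning
      x = δ v (route u (r * m))
      a = arrivals u (r * m) v

  inc-δ : ∀ c y w → inc c y w ≡ c w + δ w y
  inc-δ c y w with w ≟ y
  ... | yes _ = +-comm 1 (c w)
  ... | no _  = sym (+-identityʳ (c w))

  module Hitting (s : Fin n) (T : Subset n) (T→s : ∀ v → v ∈ T → ∀ i → head v i ≡ s) where
    open Inflow T

    step : Fin n × Vector ℕ n → Fin n × Vector ℕ n
    step (x , c) = route x (c x) , fire c x 1

    walk : ℕ → Fin n × Vector ℕ n
    walk zero    = s , (λ _ → 0)
    walk (suc k) = step (walk k)

    pos : ℕ → Fin n
    pos k = proj₁ (walk k)

    dep : ℕ → Vector ℕ n
    dep k = proj₂ (walk k)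

    walkState-agrees : ∀ k → rotorWalk s k ≡ pos k ×
                       (∀ w → proj₂ (walkState s k) w ≡ dep k w + δ w (pos k))
    walkState-agrees zero = refl , λ w → refl
    walkState-agrees (suc k) with walkState s k | walkState-agrees k
    ... | x , occ | refl , occ≡ = moves , counts
      where
      moves : vhead x (occ x) ≡ pos (suc k)
      moves = cong (vhead x) (begin
        occ x            ≡⟨ occ≡ x ⟩
        dep k x + δ x x  ≡⟨ cong (dep k x +_) (δ-refl x) ⟩
        dep k x + 1      ≡⟨ +-comm (dep k x) 1 ⟩
        suc (dep k x)    ∎)
        where open ≡-Reasoning
      counts : ∀ w → inc occ (vhead x (occ x)) w ≡ dep (suc k) w + δ w (pos (suc k))
      counts w = begin
        inc occ (vhead x (occ x)) w          ≡⟨ inc-δ occ _ w ⟩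
        occ w + δ w (vhead x (occ x))        ≡⟨ cong₂ _+_ (occ≡ w) (cong (δ w) moves) ⟩
        dep k w + δ w x + δ w (pos (suc k))
          ≡⟨ cong (λ y → dep k w + y + δ w (pos (suc k))) (*-identityˡ _) ⟨
        dep (suc k) w + δ w (pos (suc k))    ∎
        where open ≡-Reasoning

    rotorWalk≡pos : ∀ k → rotorWalk s k ≡ pos k
    rotorWalk≡pos k = proj₁ (walkState-agrees k)

    hits : ℕ → ℕ
    hits = hitsBefore s T

    hits-step : ∀ k → hits (suc k) ≡ hits k + (if does (pos k ∈? T) then 1 else 0)
    hits-step k = cong (λ x → hits k + (if does (x ∈? T) then 1 else 0)) (rotorWalk≡pos k)

    hits-∈ : ∀ k → pos k ∈ T → hits (suc k) ≡ suc (hits k)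
    hits-∈ k x∈T rewrite hits-step k | dec-true (pos k ∈? T) x∈T = +-comm (hits k) 1

    hits-∉ : ∀ k → pos k ∉ T → hits (suc k) ≡ hits k
    hits-∉ k x∉T rewrite hits-step k | dec-false (pos k ∈? T) x∉T = +-identityʳ (hits k)

    hits-mono : ∀ {k l} → k ≤ l → hits k ≤ hits l
    hits-mono = mono-≤-from-suc hits (λ k → m≤m+n (hits k) _)

    dep-mono : ∀ {k l} u → k ≤ l → dep k u ≤ dep l u
    dep-mono u = mono-≤-from-suc (λ k → dep k u) (λ k → m≤m+n (dep k u) _)

    pos-after-T : ∀ k → pos k ∈ T → pos (suc k) ≡ s
    pos-after-T k x∈T = T→s (pos k) x∈T _

    -- The chip placed at s initially and returned to s at each hit, plus the chips received
    -- from outside T, are the chips sent away plus the one now at x_k.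
    conservation : ∀ k v → δ v s * suc (hits k) + inflow (dep k) v ≡ dep k v + δ v (pos k)
    conservation zero v = begin
      δ v s * 1 + inflow (λ _ → 0) v  ≡⟨ cong₂ _+_ (*-identityʳ (δ v s)) (inflow-zero v) ⟩
      δ v s + 0                       ≡⟨ +-identityʳ (δ v s) ⟩
      δ v s                           ∎
      where open ≡-Reasoning
    conservation (suc k) v with pos k ∈? T | conservation k v
    ... | yes x∈T | IH = begin
      δ v s * suc (hits (suc k)) + inflow (fire (dep k) x 1) v
        ≡⟨ cong₂ (λ h i → δ v s * suc h + i) (hits-∈ k x∈T) (inflow-fire-∈ (dep k) {d = 1} x∈T v) ⟩
      δ v s * suc (suc (hits k)) + inflow (dep k) v      ≡⟨ a*[1+h]+i≡a+[a*h+i] (δ v s) (suc (hits k)) _ ⟩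
      δ v s + (δ v s * suc (hits k) + inflow (dep k) v)  ≡⟨ cong (δ v s +_) IH ⟩
      δ v s + (dep k v + δ v x)                          ≡⟨ a+[d+e]≡d+1*e+a (δ v s) (dep k v) (δ v x) ⟩
      dep (suc k) v + δ v s                              ≡⟨ cong (λ y → dep (suc k) v + δ v y) (pos-after-T k x∈T) ⟨
      dep (suc k) v + δ v (pos (suc k))                  ∎
      where
      open ≡-Reasoning
      x = pos k
      a*[1+h]+i≡a+[a*h+i] : ∀ a h i → a * suc h + i ≡ a + (a * h + i)
      a*[1+h]+i≡a+[a*h+i] = solve-∀
      a+[d+e]≡d+1*e+a : ∀ a d e → a + (d + e) ≡ d + 1 * e + a
      a+[d+e]≡d+1*e+a = solve-∀
    ... | no x∉T | IH = begin
      δ v s * suc (hits (suc k)) + inflow (fire (dep k) x 1) v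
        ≡⟨ cong₂ (λ h i → δ v s * suc h + i) (hits-∉ k x∉T) (inflow-fire-once (dep k) x∉T v) ⟩
      δ v s * suc (hits k) + (inflow (dep k) v + δ v y)  ≡⟨ +-assoc (δ v s * suc (hits k)) _ _ ⟨
      δ v s * suc (hits k) + inflow (dep k) v + δ v y    ≡⟨ cong (_+ δ v y) IH ⟩
      dep k v + δ v x + δ v y                            ≡⟨ cong (λ z → dep k v + z + δ v y) (*-identityˡ _) ⟨
      dep (suc k) v + δ v y                              ∎
      where
      open ≡-Reasoning
      x = pos k
      y = pos (suc k)

    hit-exists : ∀ {N K} → 0 < N → N ≤ hits K → ∃[ κ ] suc (hits κ) ≡ N × pos κ ∈ T
    hit-exists {N} {zero}  0<N N≤0 = contradiction N≤0 (<⇒≱ 0<N)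
    hit-exists {N} {suc K} 0<N N≤h with N ≤? hits K
    ... | yes N≤hK = hit-exists {K = K} 0<N N≤hK
    ... | no N≰hK with pos K ∈? T
    ...   | yes x∈T = K , ≤-antisym (≰⇒> N≰hK) (subst (N ≤_) (hits-∈ K x∈T) N≤h) , x∈T
    ...   | no x∉T  = contradiction (subst (N ≤_) (hits-∉ K x∉T) N≤h) N≰hK

    hit-after : ∀ {κ k} → pos k ∈ T → hits κ ≤ hits k → κ ≤ k
    hit-after {κ} {k} x∈T hκ≤hk with κ ≤? k
    ... | yes κ≤k = κ≤k
    ... | no κ≰k  = contradiction hκ≤hk (<⇒≱ hk<hκ)
      where
      hk<hκ : hits k < hits κ
      hk<hκ = subst (_≤ hits κ) (hits-∈ k x∈T) (hits-mono (≰⇒> κ≰k))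

    module Blocks (m : ℕ) (1≤m : 1 ≤ m) (rep : ∀ v → MRepetitive m v) where

      Aligned : Vector ℕ n → Set
      Aligned c = ∀ u → u ∉ T → m ∣ c u

      record BlockStart (b : ℕ) : Set where
        field
          time      : ℕ
          at-source : pos time ≡ s
          hits-done : hits time ≡ b * m
          aligned   : Aligned (dep time)

      module Block {b} (start : BlockStart b) where
        open BlockStart start

        M : ℕ
        M = suc b * m

        c₀ : Vector ℕ n
        c₀ = dep time

        -- The m chips of the block moved together: by m-repetitivity the next m departures
        -- from a vertex y ∉ T left a multiple of m times all go to route y (g y).
        lstep : Fin n × Vector ℕ n → Fin n × Vector ℕ n
        lstep (y , g) with y ∈? T
        ... | yes _ = y , g
        ... | no _  = route y (g y) , fire g y m

        lockstep : ℕ → Fin n × Vector ℕ n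
        lockstep zero    = s , c₀
        lockstep (suc q) = lstep (lockstep q)

        lpos : ℕ → Fin n
        lpos q = proj₁ (lockstep q)

        ldep : ℕ → Vector ℕ n
        ldep q = proj₂ (lockstep q)

        record Invariant (y : Fin n) (g : Vector ℕ n) : Set where
          field
            balance    : ∀ v → M * δ v s + inflow g v ≡ g v + m * δ v y
            g-aligned  : Aligned g
            fixed-on-T : ∀ t → t ∈ T → g t ≡ c₀ t

        invariant-start : Invariant s c₀
        invariant-start = record { balance = balance ; g-aligned = aligned ; fixed-on-T = λ _ _ → refl }
          where
          rebalance : ∀ x i c b m → x * suc (b * m) + i ≡ c + x → suc b * m * x + i ≡ c + m * x
          rebalance x i c b m eq = +-cancelˡ-≡ x _ _ (begin
            x + (suc b * m * x + i)        ≡⟨ lhs x i b m ⟩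
            m * x + (x * suc (b * m) + i)  ≡⟨ cong (m * x +_) eq ⟩
            m * x + (c + x)                ≡⟨ rhs x c m ⟩
            x + (c + m * x)                ∎)
            where
            open ≡-Reasoning
            lhs : ∀ x i b m → x + (suc b * m * x + i) ≡ m * x + (x * suc (b * m) + i)
            lhs = solve-∀
            rhs : ∀ x c m → m * x + (c + x) ≡ x + (c + m * x)
            rhs = solve-∀
          balance : ∀ v → M * δ v s + inflow c₀ v ≡ c₀ v + m * δ v s
          balance v = rebalance (δ v s) (inflow c₀ v) (c₀ v) b m (begin
            δ v s * suc (b * m) + inflow c₀ v   ≡⟨ cong (λ h → δ v s * suc h + inflow c₀ v) hits-done ⟨
            δ v s * suc (hits time) + inflow c₀ v ≡⟨ conservation time v ⟩
            c₀ v + δ v (pos time)               ≡⟨ cong (λ y → c₀ v + δ v y) at-source ⟩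
            c₀ v + δ v s                        ∎)
            where open ≡-Reasoning

        invariant-step : ∀ {y g} → Invariant y g → uncurry Invariant (lstep (y , g))
        invariant-step {y} {g} I with y ∈? T
        ... | yes _   = I
        ... | no y∉T = record { balance = balance′ ; g-aligned = aligned′ ; fixed-on-T = fixed′ }
          where
          open Invariant I
          y′ = route y (g y)
          balance′ : ∀ v → M * δ v s + inflow (fire g y m) v ≡ fire g y m v + m * δ v y′
          balance′ v = begin
            M * δ v s + inflow (fire g y m) v
              ≡⟨ cong (M * δ v s +_) (inflow-fire-block {c = g} (rep y) y∉T (g-aligned y y∉T) v) ⟩
            M * δ v s + (inflow g v + m * δ v y′)  ≡⟨ +-assoc (M * δ v s) _ _ ⟨
            M * δ v s + inflow g v + m * δ v y′    ≡⟨ cong (_+ m * δ v y′) (balance v) ⟩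
            g v + m * δ v y + m * δ v y′           ∎
            where open ≡-Reasoning
          aligned′ : Aligned (fire g y m)
          aligned′ u u∉T = ∣m∣n⇒∣m+n (g-aligned u u∉T) (m∣m*n (δ u y))
          fixed′ : ∀ t → t ∈ T → fire g y m t ≡ c₀ t
          fixed′ t t∈T = trans (fire-≢ g m (∉∧∈⇒≢ y∉T t∈T ∘ sym)) (fixed-on-T t t∈T)

        invariant : ∀ q → Invariant (lpos q) (ldep q)
        invariant zero    = invariant-start
        invariant (suc q) = invariant-step (invariant q)

        lstep-∈ : ∀ {y g} → y ∈ T → lstep (y , g) ≡ (y , g)
        lstep-∈ {y} y∈T with y ∈? T
        ... | yes _   = refl
        ... | no y∉T = contradiction y∈T y∉T

        lstep-∉ : ∀ {y g} → y ∉ T → lstep (y , g) ≡ (route y (g y) , fire g y m)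
        lstep-∉ {y} y∉T with y ∈? T
        ... | yes y∈T = contradiction y∈T y∉T
        ... | no _    = refl

        lockstep-stays : ∀ {q q′} → lpos q ∈ T → q ≤′ q′ → lockstep q′ ≡ lockstep q
        lockstep-stays y∈T ≤′-refl        = refl
        lockstep-stays y∈T (≤′-step q≤q′) = trans (cong lstep (lockstep-stays y∈T q≤q′)) (lstep-∈ y∈T)

        target-unique : ∀ {q q′} → lpos q ∈ T → lpos q′ ∈ T → lpos q ≡ lpos q′
        target-unique {q} {q′} y∈T y′∈T with ≤-total q q′
        ... | inj₁ q≤q′ = sym (cong proj₁ (lockstep-stays y∈T (≤⇒≤′ q≤q′)))
        ... | inj₂ q′≤q = cong proj₁ (lockstep-stays y′∈T (≤⇒≤′ q′≤q))

        Complete : Vector ℕ n → Set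
        Complete c = ∀ v → v ∉ T → M * δ v s + inflow c v ≡ c v

        lockstep-below : ∀ {c} → c₀ ≼ c → Complete c → ∀ q → ldep q ≼ c
        lockstep-below c₀≼c complete zero    = c₀≼c
        lockstep-below {c} c₀≼c complete (suc q) =
          step-below (invariant q) (lockstep-below c₀≼c complete q)
          where
          step-below : ∀ {y g} → Invariant y g → g ≼ c → proj₂ (lstep (y , g)) ≼ c
          step-below {y} {g} I g≼c with y ∈? T
          ... | yes _   = g≼c
          ... | no y∉T = λ u u∉T → fired≤ u u∉T (u ≟ y)
            where
            open Invariant I
            fired≤ : ∀ u → u ∉ T → Dec (u ≡ y) → fire g y m u ≤ c u
            fired≤ u u∉T (no u≢y) = ≤-trans (≤-reflexive (fire-≢ g m u≢y)) (g≼c u u∉T)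
            fired≤ u u∉T (yes refl) = begin
              g u + m * δ u u           ≡⟨ balance u ⟨
              M * δ u s + inflow g u    ≤⟨ +-monoʳ-≤ (M * δ u s) (inflow-mono g≼c u) ⟩
              M * δ u s + inflow c u    ≡⟨ complete u u∉T ⟩
              c u                       ∎
              where open ≤-Reasoning

        departures-bounded : ∀ {k q} → hits k < M → dep k ≼ ldep q →
                             dep k (pos k) < ldep q (pos k) + m * δ (pos k) (lpos q)
        departures-bounded {k} {q} hk<M dep≼g = begin-strict
          dep k x                                    <⟨ n<1+n (dep k x) ⟩
          suc (dep k x)                              ≡⟨ +-comm 1 (dep k x) ⟩
          dep k x + 1                                ≡⟨ cong (dep k x +_) (δ-refl x) ⟨
          dep k x + δ x x                            ≡⟨ conservation k x ⟨
          δ x s * suc (hits k) + inflow (dep k) x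
            ≤⟨ +-mono-≤ (*-monoʳ-≤ (δ x s) hk<M) (inflow-mono dep≼g x) ⟩
          δ x s * M + inflow (ldep q) x              ≡⟨ cong (_+ inflow (ldep q) x) (*-comm (δ x s) M) ⟩
          M * δ x s + inflow (ldep q) x              ≡⟨ Invariant.balance (invariant q) x ⟩
          ldep q x + m * δ x (lpos q)                ∎
          where
          open ≤-Reasoning
          x = pos k

        lockstep-at : ∀ {k q} → hits k < M → dep k ≼ ldep q → ldep q (pos k) ≤ dep k (pos k) →
                      lpos q ≡ pos k
        lockstep-at {k} {q} hk<M dep≼g g≤dep with lpos q ≟ pos k
        ... | yes y≡x = y≡x
        ... | no y≢x  = contradiction g≤dep (<⇒≱ (subst (dep k (pos k) <_) stays-put bounded))
          where
          bounded = departures-bounded {k} {q} hk<M dep≼g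
          stays-put : ldep q (pos k) + m * δ (pos k) (lpos q) ≡ ldep q (pos k)
          stays-put = fire-≢ (ldep q) m (y≢x ∘ sym)

        dominated-step : ∀ {k q} → hits k < M → dep k ≼ ldep q → ∃[ q′ ] dep (suc k) ≼ ldep q′
        dominated-step {k} {q} hk<M dep≼g with pos k ∈? T
        ... | yes x∈T = q , λ u u∉T → ≤-trans (≤-reflexive (fire-≢ (dep k) 1 (∉∧∈⇒≢ u∉T x∈T))) (dep≼g u u∉T)
        ... | no x∉T with m≤n⇒m<n∨m≡n (dep≼g (pos k) x∉T)
        ...   | inj₁ behind = q , λ u u∉T → fire-once-≤ {c = dep k} {g = ldep q} behind (dep≼g u u∉T)
        ...   | inj₂ level  = suc q , λ u u∉T →
                  subst (λ st → dep (suc k) u ≤ proj₂ st u) (sym (lstep-∉ (subst (_∉ T) (sym here) x∉T)))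
                        (subst (λ y → dep (suc k) u ≤ fire (ldep q) y m u) (sym here)
                               (fire-mono-≤ {c = dep k} {g = ldep q} (dep≼g u u∉T) 1≤m))
          where
          here : lpos q ≡ pos k
          here = lockstep-at {k} {q} hk<M dep≼g (≤-reflexive (sym level))

        -- Least action principle; lockstep-below is the reverse inequality.
        dominated : ∀ {k} → time ≤′ k → hits k < M → ∃[ q ] dep k ≼ ldep q
        dominated ≤′-refl              _     = 0 , λ u _ → ≤-refl
        dominated {suc k} (≤′-step t≤k) hk<M =
          let hk′<M = ≤-<-trans (hits-mono (n≤1+n k)) hk<M
              (q , dep≼g) = dominated t≤k hk′<M
          in dominated-step {k} {q} hk′<M dep≼g

        hit-at-target : ∀ {k} → time ≤ k → hits k < M → pos k ∈ T → ∃[ q ] lpos q ≡ pos k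
        hit-at-target {k} t≤k hk<M x∈T =
          let (q , dep≼g) = dominated (≤⇒≤′ t≤k) hk<M
              g≤dep = ≤-trans (≤-reflexive (Invariant.fixed-on-T (invariant q) (pos k) x∈T))
                              (dep-mono (pos k) t≤k)
          in q , lockstep-at {k} {q} hk<M dep≼g g≤dep

        hits-agree : ∀ {k k′} → time ≤ k → time ≤ k′ → hits k < M → hits k′ < M →
                     pos k ∈ T → pos k′ ∈ T → pos k ≡ pos k′
        hits-agree {k} {k′} t≤k t≤k′ hk<M hk′<M x∈T x′∈T =
          let (q , y≡x) = hit-at-target t≤k hk<M x∈T
              (q′ , y′≡x′) = hit-at-target t≤k′ hk′<M x′∈T
              y∈T = subst (_∈ T) (sym y≡x) x∈T
              y′∈T = subst (_∈ T) (sym y′≡x′) x′∈T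
          in begin
            pos k    ≡⟨ y≡x ⟨
            lpos q   ≡⟨ target-unique {q} {q′} y∈T y′∈T ⟩
            lpos q′  ≡⟨ y′≡x′ ⟩
            pos k′   ∎
          where open ≡-Reasoning

        next-block : ∀ {K} → M ≤ hits K → BlockStart (suc b)
        next-block {K} M≤hK = record
          { time = suc κ ; at-source = pos-after-T κ x∈T ; hits-done = trans (hits-∈ κ x∈T) last
          ; aligned = aligned′ }
          where
          last-hit = hit-exists {K = K} (≤-trans 1≤m (m≤m+n m (b * m))) M≤hK
          κ = proj₁ last-hit
          last = proj₁ (proj₂ last-hit)
          x∈T = proj₂ (proj₂ last-hit)
          t≤κ : time ≤ κ
          t≤κ = hit-after x∈T (begin
            hits time   ≡⟨ hits-done ⟩
            b * m       ≤⟨ s≤s⁻¹ (≤-trans (+-monoˡ-≤ (b * m) 1≤m) (≤-reflexive (sym last))) ⟩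
            hits κ      ∎)
            where open ≤-Reasoning
          complete : Complete (dep κ)
          complete v v∉T = begin
            M * δ v s + inflow (dep κ) v             ≡⟨ cong (λ h → h * δ v s + inflow (dep κ) v) last ⟨
            suc (hits κ) * δ v s + inflow (dep κ) v  ≡⟨ cong (_+ inflow (dep κ) v) (*-comm (suc (hits κ)) _) ⟩
            δ v s * suc (hits κ) + inflow (dep κ) v  ≡⟨ conservation κ v ⟩
            dep κ v + δ v (pos κ)                    ≡⟨ cong (dep κ v +_) (δ-≢ (∉∧∈⇒≢ v∉T x∈T)) ⟩
            dep κ v + 0                              ≡⟨ +-identityʳ (dep κ v) ⟩
            dep κ v                                  ∎
            where open ≡-Reasoning
          dom = dominated (≤⇒≤′ t≤κ) (≤-reflexive last)
          q = proj₁ dom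
          settled : ∀ u → u ∉ T → dep κ u ≡ ldep q u
          settled u u∉T = ≤-antisym (proj₂ dom u u∉T)
                                    (lockstep-below (λ w _ → dep-mono w t≤κ) complete q u u∉T)
          aligned′ : Aligned (dep (suc κ))
          aligned′ u u∉T = subst (m ∣_) (sym (trans (fire-≢ (dep κ) 1 (∉∧∈⇒≢ u∉T x∈T)) (settled u u∉T)))
                                 (Invariant.g-aligned (invariant q) u u∉T)

      block-start : ∀ b K → b * m ≤ hits K → BlockStart b
      block-start zero    _ _ =
        record { time = 0 ; at-source = refl ; hits-done = refl ; aligned = λ _ _ → m ∣0 }
      block-start (suc b) K M≤hK =
        Block.next-block (block-start b K (≤-trans (m≤n+m (b * m) m) M≤hK)) {K} M≤hK

      hitting-sequence-repetitive : ∀ a j k k′ → j < m →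
        IsHit s T (a * m + 1) k → IsHit s T (a * m + 1 + j) k′ → rotorWalk s k ≡ rotorWalk s k′
      hitting-sequence-repetitive a j k k′ j<m (x∈T , k-th) (x′∈T , k′-th) = begin
        rotorWalk s k   ≡⟨ rotorWalk≡pos k ⟩
        pos k           ≡⟨ Block.hits-agree start t≤k t≤k′ hk<M hk′<M (at k x∈T) (at k′ x′∈T) ⟩
        pos k′          ≡⟨ rotorWalk≡pos k′ ⟨
        rotorWalk s k′  ∎
        where
        open ≡-Reasoning
        at : ∀ k → rotorWalk s k ∈ T → pos k ∈ T
        at k = subst (_∈ T) (rotorWalk≡pos k)
        hk≡ : hits k ≡ a * m
        hk≡ = suc-injective (trans k-th (+-comm (a * m) 1))
        hk′≡ : hits k′ ≡ a * m + j
        hk′≡ = suc-injective (trans k′-th (trans (+-assoc (a * m) 1 j) (+-suc (a * m) j)))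
        start = block-start a k (≤-reflexive (sym hk≡))
        open BlockStart start
        t≤k : time ≤ k
        t≤k = hit-after (at k x∈T) (≤-reflexive (trans hits-done (sym hk≡)))
        t≤k′ : time ≤ k′
        t≤k′ = hit-after (at k′ x′∈T) (subst₂ _≤_ (sym hits-done) (sym hk′≡) (m≤m+n (a * m) j))
        hk<M : hits k < suc a * m
        hk<M = subst (_< suc a * m) (sym hk≡) (+-monoˡ-≤ (a * m) 1≤m)
        hk′<M : hits k′ < suc a * m
        hk′<M = subst₂ _<_ (sym hk′≡) (+-comm (a * m) m) (+-monoʳ-< (a * m) j<m)

theorem4 : ∀ {n : ℕ} (G : RotorGraph n) (nz : OutDegPos G) → StronglyConnected G →
    (s : Fin n) (T : Subset n) → Nonempty T →
    (∀ v → v ∈ T → ∀ i → RotorGraph.head G v i ≡ s) →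
    (m : ℕ) → 1 ≤ m → (∀ v → Walk.MRepetitive G nz m v) →
    ∀ (a j k k′ : ℕ) → j < m →
    Walk.IsHit G nz s T (a * m + 1) k → Walk.IsHit G nz s T (a * m + 1 + j) k′ →
    Walk.rotorWalk G nz s k ≡ Walk.rotorWalk G nz s k′
theorem4 G nz _ s T _ T→s m 1≤m rep a j k k′ j<m =
  Rotor.Hitting.Blocks.hitting-sequence-repetitive G nz s T T→s m 1≤m rep a j k k′ j<m
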